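{- Let $T$ be a string of length $n$ whose last character $T[n]=\$$ occurs nowhere else in $T$, let $c$ be a character different from $\$$, let $i\in\{1,\dots,n\}$, and let $T'=T[1..i-1]\,c\,T[i..n]$. Let $u\ge1$ be the smallest integer such that $T[u..i-1]$ is a common suffix of the prefix $T[1..i-1]$ and some other prefix $T[1..k]$ ($k\ne i-1$) of $T$, and let $u'\ge1$ be the smallest integer such that $T'[u'..i-1]$ is a common suffix of the prefix $T'[1..i-1]$ and some other prefix $T'[1..k']$ ($k'\ne i-1$) of $T'$. Then $|T'[u'..i-1]|\le 2|T[u..i-1]|+2$.
   Context: $S[a..b]$ denotes the substring of $S$ from position $a$ to $b$, and is the empty string (of length $0$) unless $1\le a\le b\le|S|$; prefixes $S[1..k]$ include the empty prefix ($k=0$). A string $X$ is a common suffix of two strings if it is a suffix of both. -}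

module Defs where

open import Data.Nat using (ℕ; _∸_; _≤ᵇ_; _≤_; _*_)
open import Data.Bool using (if_then_else_; _∧_)
open import Data.List using (List; []; _++_; take; drop; length)
open import Data.Product using (Σ; ∃; _×_; _,_)
open import Relation.Binary.PropositionalEquality using (_≡_; _≢_)

module _ {A : Set} where

  -- S[a..b] (1-indexed, inclusive); empty unless 1 ≤ a ≤ b ≤ |S|
  substr : List A → ℕ → ℕ → List A
  substr S a b =
    if (1 ≤ᵇ a) ∧ (a ≤ᵇ b) ∧ (b ≤ᵇ length S)
    then drop (a ∸ 1) (take b S)
    else []

  IsSuffix : List A → List A → Set
  IsSuffix X S = ∃ λ Y → Y ++ X ≡ S

  CommonSuffix : List A → List A → List A → Set
  CommonSuffix X S₁ S₂ = IsSuffix X S₁ × IsSuffix X S₂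

  SharedAt : List A → ℕ → ℕ → Set
  SharedAt T i u =
    ∃ λ k → k ≤ length T × k ≢ i ∸ 1 ×
      CommonSuffix (substr T u (i ∸ 1)) (substr T 1 (i ∸ 1)) (substr T 1 k)

  IsMinShared : List A → ℕ → ℕ → Set
  IsMinShared T i u = 1 ≤ u × SharedAt T i u × (∀ v → 1 ≤ v → SharedAt T i v → u ≤ v)

-- Write T = P ++ R with |P| = i - 1, so that T′ = P ++ c ∷ R.  The length of T[u..i-1] is the
-- largest length ℓ of a suffix X of P that also ends another prefix of T.  A suffix X of P that
-- ends a prefix of T′ either ends a prefix of T (so |X| ≤ ℓ), or it ends some P ++ c ∷ M with M a
-- prefix of R.  In the latter case either X ends M, hence P ++ M, or X = X₁ c M where X₁ ends both
-- P and the prefix of P preceding c M, and M ends both P and P ++ M; so |X| ≤ 2ℓ + 1.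
module Submission where

open import Defs
open import Data.Nat using (ℕ; zero; suc; _∸_; _≤_; _*_; _+_; _<ᵇ_; z≤n; s≤s; s≤s⁻¹)
open import Data.Nat.Properties
open import Data.Nat.Tactic.RingSolver using (solve-∀)
open import Data.List using (List; _∷_; []; _++_; length; take; drop)
open import Data.List.Properties
  using (∷-injective; ++-assoc; ++-identityʳ; ++-conicalʳ; length-++; length-++-≤ˡ; length-++-≤ʳ;
         length-take; length-drop; take++drop≡id; take-all; drop-all)
open import Data.List.Membership.Propositional using (_∈_)
open import Data.Bool using (true; false) renaming (T to True)
open import Data.Product using (∃; ∃₂; _×_; _,_; proj₁; proj₂)
open import Data.Sum using (_⊎_; inj₁; inj₂)
open import Data.Empty using (⊥-elim)
open import Function using (_∘_)
open import Relation.Nullary using (¬_)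
open import Relation.Binary.PropositionalEquality
  using (_≡_; _≢_; refl; sym; trans; cong; cong₂; subst; subst₂; module ≡-Reasoning)

T⇒≡true : ∀ {b} → True b → b ≡ true
T⇒≡true {true} _ = refl

2ℓ+1≡ℓ+1+ℓ : ∀ ℓ → 2 * ℓ + 1 ≡ ℓ + suc ℓ
2ℓ+1≡ℓ+1+ℓ = solve-∀

ℓ≤2ℓ+1 : ∀ ℓ → ℓ ≤ 2 * ℓ + 1
ℓ≤2ℓ+1 ℓ = ≤-trans (m≤m+n ℓ (ℓ + 0)) (m≤m+n (2 * ℓ) 1)

module _ {A : Set} where

  IsPrefix : List A → List A → Set
  IsPrefix Q T = ∃ λ W → Q ++ W ≡ T

  -- With T = P ++ R, SharedAt T (suc (length P)) u says exactly that T[u..|P|] is a RepeatedSuffix.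
  RepeatedSuffix : List A → List A → List A → Set
  RepeatedSuffix P T X =
    IsSuffix X P × ∃ λ Q → IsPrefix Q T × length Q ≢ length P × IsSuffix X Q

  ++-split : ∀ (Q W P V : List A) → Q ++ W ≡ P ++ V →
    (∃ λ M → Q ++ M ≡ P × W ≡ M ++ V) ⊎ (∃ λ M → P ++ M ≡ Q × M ++ W ≡ V)
  ++-split []      W P       V e = inj₁ (P , refl , e)
  ++-split (q ∷ Q) W []      V e = inj₂ (q ∷ Q , refl , e)
  ++-split (q ∷ Q) W (p ∷ P) V e with ∷-injective e
  ... | refl , e′ with ++-split Q W P V e′
  ...   | inj₁ (M , QM≡P , W≡MV) = inj₁ (M , cong (q ∷_) QM≡P , W≡MV)
  ...   | inj₂ (M , PM≡Q , MW≡V) = inj₂ (M , cong (q ∷_) PM≡Q , MW≡V)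

  length-++-≢ : ∀ (Q : List A) {M} → M ≢ [] → length Q ≢ length (Q ++ M)
  length-++-≢ Q {[]}    M≢[] _ = M≢[] refl
  length-++-≢ Q {m ∷ M} _    e = m+1+n≢m (length Q) (sym (trans e (length-++ Q)))

  suffix-length-≤ : ∀ {X P : List A} → IsSuffix X P → length X ≤ length P
  suffix-length-≤ {X} (Y , refl) = length-++-≤ʳ X {Y}

  take-length-++ : ∀ (Q W : List A) → take (length Q) (Q ++ W) ≡ Q
  take-length-++ []      W = refl
  take-length-++ (q ∷ Q) W = cong (q ∷_) (take-length-++ Q W)

  drop-length-++ : ∀ (Q W : List A) → drop (length Q) (Q ++ W) ≡ W
  drop-length-++ []      W = refl
  drop-length-++ (q ∷ Q) W = drop-length-++ Q W

  drop-∸-suffix : ∀ {X P : List A} → IsSuffix X P → drop (length P ∸ length X) P ≡ X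
  drop-∸-suffix {X} (Y , refl)
    rewrite length-++ Y {X} | m+n∸n≡m (length Y) (length X) = drop-length-++ Y X

  length-take-≤ : ∀ {k} (xs : List A) → k ≤ length xs → length (take k xs) ≡ k
  length-take-≤ {k} xs k≤ = trans (length-take k xs) (m≤n⇒m⊓n≡m k≤)

  splitAt-length : ∀ (T : List A) L → L ≤ length T → ∃₂ λ P R → length P ≡ L × P ++ R ≡ T
  splitAt-length T       zero    _       = [] , T , refl , refl
  splitAt-length (x ∷ T) (suc L) (s≤s p) with splitAt-length T L p
  ... | P , R , refl , refl = x ∷ P , R , refl , refl

  substr-1 : ∀ (xs : List A) k → k ≤ length xs → substr xs 1 k ≡ take k xs
  substr-1 xs zero    _  = refl
  substr-1 xs (suc k) k≤ rewrite T⇒≡true (≤⇒≤ᵇ k≤) = refl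

  substr-suc : ∀ (xs : List A) u L → L ≤ length xs → substr xs (suc u) L ≡ drop u (take L xs)
  substr-suc xs u L L≤ with u <ᵇ L in u<ᵇL
  ... | true rewrite T⇒≡true (≤⇒≤ᵇ L≤) = refl
  ... | false = sym (drop-all u (take L xs) take-short)
    where
      L≤u : L ≤ u
      L≤u = s≤s⁻¹ (≰⇒> (λ u<L → subst True u<ᵇL (<⇒<ᵇ u<L)))
      take-short : length (take L xs) ≤ u
      take-short = ≤-trans (≤-reflexive (length-take L xs)) (≤-trans (m⊓n≤m L (length xs)) L≤u)

  substr-++-prefix : ∀ (P R : List A) → substr (P ++ R) 1 (length P) ≡ P
  substr-++-prefix P R = trans (substr-1 (P ++ R) (length P) (length-++-≤ˡ P)) (take-length-++ P R)

  substr-++-window : ∀ (P R : List A) u → substr (P ++ R) (suc u) (length P) ≡ drop u P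
  substr-++-window P R u =
    trans (substr-suc (P ++ R) u (length P) (length-++-≤ˡ P)) (cong (drop u) (take-length-++ P R))

  substr-++-rest : ∀ (P R : List A) → substr (P ++ R) (suc (length P)) (length (P ++ R)) ≡ R
  substr-++-rest P R = begin
    substr (P ++ R) (suc (length P)) (length (P ++ R)) ≡⟨ substr-suc (P ++ R) (length P) _ ≤-refl ⟩
    drop (length P) (take (length (P ++ R)) (P ++ R))  ≡⟨ cong (drop (length P)) (take-all _ (P ++ R) ≤-refl) ⟩
    drop (length P) (P ++ R)                           ≡⟨ drop-length-++ P R ⟩
    R                                                  ∎
    where open ≡-Reasoning

  sharedAt⇒repeatedSuffix : ∀ (P R : List A) u → SharedAt (P ++ R) (suc (length P)) u →
    RepeatedSuffix P (P ++ R) (substr (P ++ R) u (length P))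
  sharedAt⇒repeatedSuffix P R u (k , k≤ , k≢|P| , X-ends-P , X-ends-Q) =
    subst (IsSuffix X) (substr-++-prefix P R) X-ends-P ,
    take k T , (drop k T , take++drop≡id k T) ,
    k≢|P| ∘ trans (sym (length-take-≤ T k≤)) ,
    subst (IsSuffix X) (substr-1 T k k≤) X-ends-Q
    where
      T = P ++ R
      X = substr T u (length P)

  repeatedSuffix⇒sharedAt : ∀ (P R : List A) {X} → RepeatedSuffix P (P ++ R) X →
    SharedAt (P ++ R) (suc (length P)) (suc (length P ∸ length X))
  repeatedSuffix⇒sharedAt P R {X} (X-ends-P , Q , (W , QW≡T) , |Q|≢|P| , X-ends-Q) =
    length Q , subst (λ T → length Q ≤ length T) QW≡T (length-++-≤ˡ Q) , |Q|≢|P| ,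
    subst₂ IsSuffix (sym window≡X) (sym (substr-++-prefix P R)) X-ends-P ,
    subst₂ IsSuffix (sym window≡X) (sym prefix≡Q) X-ends-Q
    where
      window≡X : substr (P ++ R) (suc (length P ∸ length X)) (length P) ≡ X
      window≡X = trans (substr-++-window P R _) (drop-∸-suffix X-ends-P)
      prefix≡Q : substr (P ++ R) 1 (length Q) ≡ Q
      prefix≡Q = subst (λ T → substr T 1 (length Q) ≡ Q) QW≡T (substr-++-prefix Q W)

  -- Minimality of u turns every repeated suffix into a witness v = |P| - |X| + 1 ≥ u.
  isMinShared⇒repeatedSuffix-≤ : ∀ (P R : List A) u → IsMinShared (P ++ R) (suc (length P)) u →
    ∀ {X} → RepeatedSuffix P (P ++ R) X → length X ≤ length (substr (P ++ R) u (length P))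
  isMinShared⇒repeatedSuffix-≤ P R zero    (() , _)
  isMinShared⇒repeatedSuffix-≤ P R (suc u) (_ , _ , minimal) {X} repeated = begin
    length X                        ≡⟨ sym (m∸[m∸n]≡n (suffix-length-≤ (proj₁ repeated))) ⟩
    length P ∸ (length P ∸ length X) ≤⟨ ∸-monoʳ-≤ (length P) u≤v ⟩
    length P ∸ u                     ≡⟨ sym (length-drop u P) ⟩
    length (drop u P)                ≡⟨ cong length (substr-++-window P R u) ⟨
    length (substr (P ++ R) (suc u) (length P)) ∎
    where
      open ≤-Reasoning
      u≤v : u ≤ length P ∸ length X
      u≤v = s≤s⁻¹ (minimal _ (s≤s z≤n) (repeatedSuffix⇒sharedAt P R repeated))

  module Insertion (P R : List A) (c : A) {ℓ : ℕ}
                   (bounded : ∀ {X} → RepeatedSuffix P (P ++ R) X → length X ≤ ℓ) where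

    bounded-within : ∀ {X} Q M → Q ++ M ≡ P → length Q ≢ length P →
      IsSuffix X P → IsSuffix X Q → length X ≤ ℓ
    bounded-within Q M QM≡P |Q|≢|P| X-ends-P X-ends-Q =
      bounded (X-ends-P , Q , (M ++ R , QMR≡PR) , |Q|≢|P| , X-ends-Q)
      where
        QMR≡PR : Q ++ M ++ R ≡ P ++ R
        QMR≡PR = trans (sym (++-assoc Q M R)) (cong (_++ R) QM≡P)

    bounded-beyond : ∀ {X} M W → M ++ W ≡ R → IsSuffix X P → IsSuffix X M → length X ≤ ℓ
    bounded-beyond {[]}    M W MW≡R _        _          = z≤n
    bounded-beyond {x ∷ X} M W MW≡R X-ends-P (Z , refl) =
      bounded (X-ends-P , P ++ M , (W , PMW≡PR) , |PM|≢|P| , (P ++ Z , ++-assoc P Z (x ∷ X)))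
      where
        PMW≡PR : (P ++ M) ++ W ≡ P ++ R
        PMW≡PR = trans (++-assoc P M W) (cong (P ++_) MW≡R)
        |PM|≢|P| : length (P ++ M) ≢ length P
        |PM|≢|P| = length-++-≢ P ((λ ()) ∘ ++-conicalʳ Z (x ∷ X)) ∘ sym

    straddling-≤ : ∀ X₁ M W → M ++ W ≡ R → IsSuffix X₁ P → IsSuffix (X₁ ++ c ∷ M) P →
      length (X₁ ++ c ∷ M) ≤ 2 * ℓ + 1
    straddling-≤ X₁ M W MW≡R X₁-ends-P (Y , YX≡P) = begin
      length (X₁ ++ c ∷ M)      ≡⟨ length-++ X₁ ⟩
      length X₁ + suc (length M) ≤⟨ +-mono-≤ X₁-≤ (s≤s M-≤) ⟩
      ℓ + suc ℓ                  ≡⟨ 2ℓ+1≡ℓ+1+ℓ ℓ ⟨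
      2 * ℓ + 1                  ∎
      where
        open ≤-Reasoning
        Y₁cM≡P : (Y ++ X₁) ++ c ∷ M ≡ P
        Y₁cM≡P = trans (++-assoc Y X₁ (c ∷ M)) YX≡P
        X₁-≤ : length X₁ ≤ ℓ
        X₁-≤ = bounded-within (Y ++ X₁) (c ∷ M) Y₁cM≡P
                 (λ e → length-++-≢ (Y ++ X₁) (λ ()) (trans e (cong length (sym Y₁cM≡P))))
                 X₁-ends-P (Y , refl)
        M-≤ : length M ≤ ℓ
        M-≤ = bounded-beyond M W MW≡R ((Y ++ X₁) ++ c ∷ [] , trans (++-assoc (Y ++ X₁) (c ∷ []) M) Y₁cM≡P)
                ([] , refl)

    bounded-after-c : ∀ {X} M W → M ++ W ≡ R → IsSuffix X P → IsSuffix X (P ++ c ∷ M) →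
      length X ≤ 2 * ℓ + 1
    bounded-after-c {X} M W MW≡R X-ends-P (Y , YX≡PcM) with ++-split Y X P (c ∷ M) YX≡PcM
    ... | inj₁ (X₁ , YX₁≡P , refl) = straddling-≤ X₁ M W MW≡R (Y , YX₁≡P) X-ends-P
    ... | inj₂ ([] , _ , refl)     = straddling-≤ [] M W MW≡R (P , ++-identityʳ P) X-ends-P
    ... | inj₂ (_ ∷ Z , _ , cZX≡cM) =
      ≤-trans (bounded-beyond M W MW≡R X-ends-P (Z , proj₂ (∷-injective cZX≡cM))) (ℓ≤2ℓ+1 ℓ)

    repeatedSuffix-insert-≤ : ∀ {X} → RepeatedSuffix P (P ++ c ∷ R) X → length X ≤ 2 * ℓ + 1
    repeatedSuffix-insert-≤ (X-ends-P , Q , (W , QW≡PcR) , |Q|≢|P| , X-ends-Q)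
      with ++-split Q W P (c ∷ R) QW≡PcR
    ... | inj₁ (M , QM≡P , _) = ≤-trans (bounded-within Q M QM≡P |Q|≢|P| X-ends-P X-ends-Q) (ℓ≤2ℓ+1 ℓ)
    ... | inj₂ ([] , P≡Q , _) = ⊥-elim (|Q|≢|P| (cong length (trans (sym P≡Q) (++-identityʳ P))))
    ... | inj₂ (_ ∷ M , refl , cMW≡cR) with ∷-injective cMW≡cR
    ...   | refl , MW≡R = bounded-after-c M W MW≡R X-ends-P X-ends-Q

insertion-≤ : ∀ {A : Set} (P R : List A) c u u′ →
  IsMinShared (P ++ R) (suc (length P)) u → SharedAt (P ++ c ∷ R) (suc (length P)) u′ →
  length (substr (P ++ c ∷ R) u′ (length P)) ≤ 2 * length (substr (P ++ R) u (length P)) + 1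
insertion-≤ P R c u u′ minimal shared′ =
  Insertion.repeatedSuffix-insert-≤ P R c (isMinShared⇒repeatedSuffix-≤ P R u minimal)
    (sharedAt⇒repeatedSuffix P (c ∷ R) u′ shared′)

lemma20 : {A : Set} (dollar : A) (S T : List A) (n : ℕ) →
    T ≡ S ++ (dollar ∷ []) → ¬ (dollar ∈ S) → length T ≡ n →
    (c : A) → c ≢ dollar →
    (i : ℕ) → 1 ≤ i → i ≤ n →
    (T′ : List A) → T′ ≡ substr T 1 (i ∸ 1) ++ (c ∷ []) ++ substr T i n →
    (u u′ : ℕ) → IsMinShared T i u → IsMinShared T′ i u′ →
    length (substr T′ u′ (i ∸ 1)) ≤ 2 * length (substr T u (i ∸ 1)) + 2
lemma20 _ _ T _ _ _ refl c _ (suc L) _ i≤n T′ T′≡ u u′ minimal (_ , shared′ , _)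
  with splitAt-length T L (<⇒≤ i≤n)
... | P , R , refl , refl
  with trans T′≡ (cong₂ (λ P′ R′ → P′ ++ c ∷ R′) (substr-++-prefix P R) (substr-++-rest P R))
...   | refl = ≤-trans (insertion-≤ P R c u u′ minimal shared′) (+-monoʳ-≤ _ (n≤1+n 1))
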